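{- For each integer $p>2$, there is a connected $(7p-3)$-regular integral graph with $12p$ vertices.
   Context: A graph is integral if all eigenvalues of its adjacency matrix are integers. -}

module Defs where

open import Data.Nat using (ℕ; suc)
open import Data.Bool using (Bool; true; false; if_then_else_)
open import Data.Fin using (Fin; _≟_)
open import Data.List using (List; allFin; map; foldr)
open import Data.Integer using (ℤ)
open import Data.Rational using (ℚ; 0ℚ; 1ℚ; _+_; _*_)
import Data.Rational as ℚ
open import Data.Product using (Σ; _×_)
open import Relation.Binary.PropositionalEquality using (_≡_)
open import Relation.Nullary.Decidable using (⌊_⌋)

record SimpleGraph (n : ℕ) : Set where
  field
    adj    : Fin n → Fin n → Bool
    sym    : ∀ u v → adj u v ≡ adj v u
    irrefl : ∀ v → adj v v ≡ false
open SimpleGraph public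

degree : ∀ {n} → SimpleGraph n → Fin n → ℕ
degree {n} G v = foldr Data.Nat._+_ 0 (map (λ w → if adj G v w then 1 else 0) (allFin n))

Regular : ∀ {n} → SimpleGraph n → ℕ → Set
Regular G k = ∀ v → degree G v ≡ k

data Reachable {n} (G : SimpleGraph n) (u : Fin n) : Fin n → Set where
  here : Reachable G u u
  step : ∀ {v w} → Reachable G u v → adj G v w ≡ true → Reachable G u w

Connected : ∀ {n} → SimpleGraph n → Set
Connected {n} G = ∀ (u v : Fin n) → Reachable G u v

Matrix : ℕ → Set
Matrix n = Fin n → Fin n → ℚ

Σℚ : ∀ {n} → (Fin n → ℚ) → ℚ
Σℚ {n} f = foldr _+_ 0ℚ (map f (allFin n))

_⊗_ : ∀ {n} → Matrix n → Matrix n → Matrix n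
(A ⊗ B) i j = Σℚ (λ k → A i k * B k j)

identity : ∀ {n} → Matrix n
identity i j = if ⌊ i ≟ j ⌋ then 1ℚ else 0ℚ

diag : ∀ {n} → (Fin n → ℚ) → Matrix n
diag d i j = if ⌊ i ≟ j ⌋ then d i else 0ℚ

adjMatrix : ∀ {n} → SimpleGraph n → Matrix n
adjMatrix G i j = if adj G i j then 1ℚ else 0ℚ

-- Since the adjacency matrix A is real symmetric, it is diagonalisable and its
-- eigenvalues (with multiplicity) are exactly the diagonal of any diagonalisation.
-- We express "all eigenvalues are integers" as: there are integers λ₁..λₙ and an
-- invertible matrix P (over ℚ, with left inverse Q, Q P = I) such that
-- A P = P diag(λ), i.e. the columns of P form an eigenbasis with integer eigenvalues.
Integral : ∀ {n} → SimpleGraph n → Set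
Integral {n} G =
  Σ (Fin n → ℤ) λ ev →
  Σ (Matrix n) λ P →
  Σ (Matrix n) λ Q →
    (∀ i j → (adjMatrix G ⊗ P) i j ≡ (P ⊗ diag (λ k → ev k ℚ./ 1)) i j)
    × (∀ i j → (Q ⊗ P) i j ≡ identity i j)

-- Let E be the graph on the cells of a 3 × 4 grid joining two cells that lie in different rows
-- and in columns of different parity, and let D relate cells in the same column. Blowing every
-- cell up into p vertices, with (i, a) ~ (j, b) iff i ~ j in E, or i and j share a column and
-- a ≠ b, gives a graph that is connected (E is connected and every fibre is a clique) and has
-- degree 4p + 3(p - 1) = 7p - 3. Its adjacency matrix is (E + D) ⊗ J - D ⊗ I, with J the all-ones
-- p × p matrix. A common eigenbasis of E + D and D with integer eigenvalues h and d, tensored with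
-- the eigenbasis of J (eigenvalues p and 0), diagonalises it with the integer eigenvalues h p - d and -d.

module Submission where

open import Defs hiding (sym)

-- ℚ is opened only inside Construction, so that _*_ in the statement of corollary2 is ℕ's.
module Construction where

  open import Algebra.Bundles using (Monoid; Ring; CommutativeMonoid)
  open import Data.Bool as Bool using (Bool; true; false; if_then_else_; _∧_; _∨_; not)
  open import Data.Bool.Properties using (∧-zeroʳ; ∨-zeroʳ)
  open import Data.Fin using (Fin; zero; suc; combine; quotient; remainder; _↑ˡ_; _↑ʳ_; _≟_)
  open import Data.Fin.Properties
    using (remQuot-combine; combine-injectiveˡ; combine-injectiveʳ; combine-surjective; suc-injective; any?; all?)
  open import Data.Integer as ℤ using (ℤ; +_; -[1+_])
  import Data.Integer.Properties as ℤP
  open import Data.List using (foldr; tabulate)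
  open import Data.List.Properties using (map-tabulate)
  open import Data.Nat as ℕ using (ℕ; zero; suc)
  import Data.Nat.Coprimality as Coprime
  import Data.Nat.Properties as ℕP
  open import Data.Nat.Tactic.RingSolver using (solve-∀)
  open import Data.Product using (∃; _×_; _,_; proj₁; proj₂)
  open import Data.Rational using (ℚ; mkℚ; 0ℚ; 1ℚ; _+_; _*_; -_; _-_; _/_; 1/_)
  import Data.Rational.Properties as ℚP
  open import Data.Rational.Solver using (module +-*-Solver)
  open import Data.Sum using (_⊎_; inj₁; inj₂)
  open import Data.Vec using (_∷_; []; lookup)
  import Data.Vec.Functional as Vector
  open import Function using (_∘_)
  open import Relation.Binary.PropositionalEquality
  open import Relation.Nullary.Decidable
    using (Dec; ⌊_⌋; yes; no; dec-true; dec-false; isYes≗does; _⊎-dec_; _×-dec_; from-yes)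
  open import Relation.Nullary.Negation using (¬_)

  foldr-tabulate : ∀ {A B : Set} {n} (_∙_ : A → B → B) (e : B) (f : Fin n → A) →
                   foldr _∙_ e (tabulate f) ≡ Vector.foldr _∙_ e f
  foldr-tabulate {n = zero}  _∙_ e f = refl
  foldr-tabulate {n = suc n} _∙_ e f = cong (f zero ∙_) (foldr-tabulate _∙_ e (f ∘ suc))

  module MonoidSum {c ℓ} (M : Monoid c ℓ) where
    open Monoid M renaming (_∙_ to _⊕_; ε to 0#; sym to ≈-sym; trans to ≈-trans; refl to ≈-refl)
    open import Algebra.Properties.Monoid.Sum M using (sum; sum-cong-≋; sum-replicate-zero)

    sum-↑ : ∀ m {n} (f : Fin (m ℕ.+ n) → Carrier) →
            sum f ≈ sum (λ i → f (i ↑ˡ n)) ⊕ sum (λ j → f (m ↑ʳ j))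
    sum-↑ zero    f = ≈-sym (identityˡ _)
    sum-↑ (suc m) f = ≈-trans (∙-congˡ (sum-↑ m (f ∘ suc))) (≈-sym (assoc _ _ _))

    sum-combine : ∀ m {n} (f : Fin (m ℕ.* n) → Carrier) →
                  sum f ≈ sum (λ i → sum (λ j → f (combine {m} {n} i j)))
    sum-combine zero        f = ≈-refl
    sum-combine (suc m) {n} f = ≈-trans (sum-↑ n f) (∙-congˡ (sum-combine m (f ∘ (n ↑ʳ_))))

    sum-single : ∀ {n} (c : Fin n) (f : Fin n → Carrier) → (∀ k → k ≢ c → f k ≈ 0#) → sum f ≈ f c
    sum-single {suc n} zero    f vanish =
      ≈-trans (∙-congˡ (≈-trans (sum-cong-≋ (λ k → vanish (suc k) λ ())) (sum-replicate-zero n))) (identityʳ _)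
    sum-single {suc n} (suc c) f vanish =
      ≈-trans (∙-cong (vanish zero λ ()) (sum-single c (f ∘ suc) λ k k≢c → vanish (suc k) (k≢c ∘ suc-injective)))
            (identityˡ _)

  module ℕΣ where
    open import Algebra.Properties.Semiring.Sum ℕP.+-*-semiring public
      using (sum; sum-cong-≗; ∑-distrib-+; *-distribʳ-sum; sum-replicate-zero)
    open MonoidSum ℕP.+-0-monoid public using (sum-combine; sum-single)

  open import Algebra.Properties.Semiring.Sum (Ring.semiring ℚP.+-*-ring)
    using (sum; sum-cong-≗; ∑-distrib-+; *-distribˡ-sum; *-distribʳ-sum)
  open MonoidSum ℚP.+-0-monoid using (sum-combine; sum-single)
  open import Algebra.Properties.Ring ℚP.+-*-ring using (x[y-z]≈xy-xz; [y-z]x≈yx-zx; -‿involutive)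
  open import Algebra.Properties.CommutativeSemigroup (CommutativeMonoid.commutativeSemigroup ℚP.*-1-commutativeMonoid)
    using (interchange)

  sum-neg : ∀ {n} (f : Fin n → ℚ) → sum (λ k → - f k) ≡ - sum f
  sum-neg {zero}  f = refl
  sum-neg {suc n} f = trans (cong (_+_ (- f zero)) (sum-neg (f ∘ suc))) (sym (ℚP.neg-distrib-+ (f zero) _))

  ∑-distrib-− : ∀ {n} (f g : Fin n → ℚ) → sum (λ k → f k - g k) ≡ sum f - sum g
  ∑-distrib-− f g = trans (∑-distrib-+ f (λ k → - g k)) (cong (_+_ (sum f)) (sum-neg g))

  Σℚ≡sum : ∀ {n} (f : Fin n → ℚ) → Σℚ f ≡ sum f
  Σℚ≡sum f = trans (cong (foldr _+_ 0ℚ) (map-tabulate (λ i → i) f)) (foldr-tabulate _+_ 0ℚ f)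

  toℚ : ℤ → ℚ
  toℚ z = z / 1

  -- mkℚ z 0 _ is the normal form of z / 1; on it, ℚ arithmetic reduces to ℤ arithmetic.
  toℚ≡mkℚ : ∀ z → toℚ z ≡ mkℚ z 0 (Coprime.sym (Coprime.1-coprimeTo _))
  toℚ≡mkℚ z = ℚP.↥p/↧p≡p (mkℚ z 0 _)

  toℚ-homo-+ : ∀ a b → toℚ (a ℤ.+ b) ≡ toℚ a + toℚ b
  toℚ-homo-+ a b = begin
    toℚ (a ℤ.+ b)                  ≡⟨ cong toℚ (cong₂ ℤ._+_ (ℤP.*-identityʳ a) (ℤP.*-identityʳ b)) ⟨
    toℚ (a ℤ.* + 1 ℤ.+ b ℤ.* + 1)  ≡⟨ cong₂ _+_ (toℚ≡mkℚ a) (toℚ≡mkℚ b) ⟨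
    toℚ a + toℚ b                  ∎
    where open ≡-Reasoning

  toℚ-homo-* : ∀ a b → toℚ (a ℤ.* b) ≡ toℚ a * toℚ b
  toℚ-homo-* a b = sym (cong₂ _*_ (toℚ≡mkℚ a) (toℚ≡mkℚ b))

  toℚ-homo‿- : ∀ a → toℚ (ℤ.- a) ≡ - toℚ a
  toℚ-homo‿- (+ zero)    = refl
  toℚ-homo‿- (+ suc n)   = refl
  toℚ-homo‿- -[1+ n ]    = sym (-‿involutive (toℚ (+ suc n)))

  toℚ-homo-− : ∀ a b → toℚ (a ℤ.- b) ≡ toℚ a - toℚ b
  toℚ-homo-− a b = trans (toℚ-homo-+ a (ℤ.- b)) (cong (_+_ (toℚ a)) (toℚ-homo‿- b))

  ⌊⌋-true : ∀ {A : Set} (a? : Dec A) → A → ⌊ a? ⌋ ≡ true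
  ⌊⌋-true a? a = trans (isYes≗does a?) (dec-true a? a)

  ⌊⌋-false : ∀ {A : Set} (a? : Dec A) → ¬ A → ⌊ a? ⌋ ≡ false
  ⌊⌋-false a? ¬a = trans (isYes≗does a?) (dec-false a? ¬a)

  combine-elim : ∀ {m n} (P : Fin (m ℕ.* n) → Set) → (∀ i j → P (combine i j)) → ∀ x → P x
  combine-elim {m} {n} P p x with i , j , refl ← combine-surjective {m} {n} x = p i j

  quotient-combine : ∀ {m n} (a : Fin m) (b : Fin n) → quotient {m} n (combine a b) ≡ a
  quotient-combine a b = cong proj₁ (remQuot-combine a b)

  remainder-combine : ∀ {m n} (a : Fin m) (b : Fin n) → remainder {m} n (combine a b) ≡ b
  remainder-combine a b = cong proj₂ (remQuot-combine a b)

  combine-≟ : ∀ {m n} (a c : Fin m) (b d : Fin n) → ⌊ combine a b ≟ combine c d ⌋ ≡ ⌊ a ≟ c ⌋ ∧ ⌊ b ≟ d ⌋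
  combine-≟ a c b d with a ≟ c | b ≟ d
  ... | yes refl | yes refl = ⌊⌋-true (combine a b ≟ combine a b) refl
  ... | yes refl | no b≢d   = ⌊⌋-false (combine a b ≟ combine a d) (b≢d ∘ combine-injectiveʳ a b a d)
  ... | no a≢c   | _        = ⌊⌋-false (combine a b ≟ combine c d) (a≢c ∘ combine-injectiveˡ a b c d)

  ≟-sym : ∀ {n} (a b : Fin n) → ⌊ a ≟ b ⌋ ≡ ⌊ b ≟ a ⌋
  ≟-sym a b with a ≟ b
  ... | yes refl = sym (⌊⌋-true (a ≟ a) refl)
  ... | no a≢b   = sym (⌊⌋-false (b ≟ a) (a≢b ∘ sym))

  -- Kronecker products and eigenvectors

  infix  4 _≋_
  infixl 6 _⊖_
  infixl 7 _⊠_ _⊠ᵛ_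

  _≋_ : ∀ {n} → Matrix n → Matrix n → Set
  M ≋ N = ∀ i j → M i j ≡ N i j

  _⊖_ : ∀ {n} → Matrix n → Matrix n → Matrix n
  (M ⊖ N) i j = M i j - N i j

  _⊠_ : ∀ {m n} → Matrix m → Matrix n → Matrix (m ℕ.* n)
  _⊠_ {m} {n} M N x y = M (quotient {m} n x) (quotient {m} n y) * N (remainder {m} n x) (remainder {m} n y)

  _⊠ᵛ_ : ∀ {m n} → (Fin m → ℚ) → (Fin n → ℚ) → Fin (m ℕ.* n) → ℚ
  _⊠ᵛ_ {m} {n} μ ν x = μ (quotient {m} n x) * ν (remainder {m} n x)

  ⊠-combine : ∀ {m n} (M : Matrix m) (N : Matrix n) a b c d →
              (M ⊠ N) (combine a b) (combine c d) ≡ M a c * N b d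
  ⊠-combine M N a b c d =
    cong₂ _*_ (cong₂ M (quotient-combine a b) (quotient-combine c d))
              (cong₂ N (remainder-combine a b) (remainder-combine c d))

  ⊠ᵛ-combine : ∀ {m n} (μ : Fin m → ℚ) (ν : Fin n → ℚ) a b → (μ ⊠ᵛ ν) (combine a b) ≡ μ a * ν b
  ⊠ᵛ-combine μ ν a b = cong₂ _*_ (cong μ (quotient-combine a b)) (cong ν (remainder-combine a b))

  ≋-combine : ∀ {m n} {F G : Matrix (m ℕ.* n)} →
              (∀ (a : Fin m) (b : Fin n) c d → F (combine a b) (combine c d) ≡ G (combine a b) (combine c d)) →
              F ≋ G
  ≋-combine {m} {n} {F} {G} h x y =
    combine-elim {m} {n} (λ x → F x y ≡ G x y)
      (λ a b → combine-elim {m} {n} (λ y → F (combine a b) y ≡ G (combine a b) y) (h a b) y) x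

  ⊠-cong : ∀ {m n} {M M' : Matrix m} {N N' : Matrix n} → M ≋ M' → N ≋ N' → M ⊠ N ≋ M' ⊠ N'
  ⊠-cong eM eN x y = cong₂ _*_ (eM _ _) (eN _ _)

  ⊗-sum : ∀ {n} (A B : Matrix n) i j → (A ⊗ B) i j ≡ sum (λ k → A i k * B k j)
  ⊗-sum A B i j = Σℚ≡sum (λ k → A i k * B k j)

  ⊗-cong : ∀ {n} {A A' B B' : Matrix n} → A ≋ A' → B ≋ B' → A ⊗ B ≋ A' ⊗ B'
  ⊗-cong {A = A} {A'} {B} {B'} eA eB i j =
    trans (⊗-sum A B i j) (trans (sum-cong-≗ (λ k → cong₂ _*_ (eA i k) (eB k j))) (sym (⊗-sum A' B' i j)))

  diag-on : ∀ {n} (d : Fin n → ℚ) i → diag d i i ≡ d i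
  diag-on d i = cong (λ b → if b then d i else 0ℚ) (⌊⌋-true (i ≟ i) refl)

  diag-off : ∀ {n} (d : Fin n → ℚ) {i j} → i ≢ j → diag d i j ≡ 0ℚ
  diag-off d {i} {j} i≢j = cong (λ b → if b then d i else 0ℚ) (⌊⌋-false (i ≟ j) i≢j)

  ⊗-diag : ∀ {n} (M : Matrix n) d i j → (M ⊗ diag d) i j ≡ M i j * d j
  ⊗-diag M d i j = begin
    (M ⊗ diag d) i j               ≡⟨ ⊗-sum M (diag d) i j ⟩
    sum (λ k → M i k * diag d k j) ≡⟨ sum-single j _ off-diagonal ⟩
    M i j * diag d j j             ≡⟨ cong (M i j *_) (diag-on d j) ⟩
    M i j * d j                    ∎
    where
    open ≡-Reasoning
    off-diagonal : ∀ k → k ≢ j → M i k * diag d k j ≡ 0ℚ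
    off-diagonal k k≢j = trans (cong (M i k *_) (diag-off d k≢j)) (ℚP.*-zeroʳ (M i k))

  diag-⊗ : ∀ {n} (M : Matrix n) d i j → (diag d ⊗ M) i j ≡ d i * M i j
  diag-⊗ M d i j = begin
    (diag d ⊗ M) i j               ≡⟨ ⊗-sum (diag d) M i j ⟩
    sum (λ k → diag d i k * M k j) ≡⟨ sum-single i _ off-diagonal ⟩
    diag d i i * M i j             ≡⟨ cong (_* M i j) (diag-on d i) ⟩
    d i * M i j                    ∎
    where
    open ≡-Reasoning
    off-diagonal : ∀ k → k ≢ i → diag d i k * M k j ≡ 0ℚ
    off-diagonal k k≢i = trans (cong (_* M k j) (diag-off d (k≢i ∘ sym))) (ℚP.*-zeroˡ (M k j))

  ⊗-identityʳ : ∀ {n} (M : Matrix n) → M ⊗ identity ≋ M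
  ⊗-identityʳ M i j = trans (⊗-diag M (λ _ → 1ℚ) i j) (ℚP.*-identityʳ _)

  ⊗-identityˡ : ∀ {n} (M : Matrix n) → identity ⊗ M ≋ M
  ⊗-identityˡ M i j = trans (diag-⊗ M (λ _ → 1ℚ) i j) (ℚP.*-identityˡ _)

  ⊗-distribʳ-⊖ : ∀ {n} (A B X : Matrix n) → (A ⊖ B) ⊗ X ≋ (A ⊗ X) ⊖ (B ⊗ X)
  ⊗-distribʳ-⊖ A B X i j = begin
    ((A ⊖ B) ⊗ X) i j
      ≡⟨ ⊗-sum (A ⊖ B) X i j ⟩
    sum (λ k → (A i k - B i k) * X k j)
      ≡⟨ sum-cong-≗ (λ k → [y-z]x≈yx-zx (X k j) (A i k) (B i k)) ⟩
    sum (λ k → A i k * X k j - B i k * X k j)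
      ≡⟨ ∑-distrib-− (λ k → A i k * X k j) (λ k → B i k * X k j) ⟩
    sum (λ k → A i k * X k j) - sum (λ k → B i k * X k j)
      ≡⟨ cong₂ _-_ (⊗-sum A X i j) (⊗-sum B X i j) ⟨
    (A ⊗ X) i j - (B ⊗ X) i j ∎
    where open ≡-Reasoning

  ⊠-⊗ : ∀ {m n} (M M' : Matrix m) (N N' : Matrix n) → (M ⊠ N) ⊗ (M' ⊠ N') ≋ (M ⊗ M') ⊠ (N ⊗ N')
  ⊠-⊗ {m} {n} M M' N N' = ≋-combine {m} {n} λ a b c d → begin
    ((M ⊠ N) ⊗ (M' ⊠ N')) (combine a b) (combine c d)
      ≡⟨ ⊗-sum (M ⊠ N) (M' ⊠ N') _ _ ⟩
    sum (λ z → (M ⊠ N) (combine a b) z * (M' ⊠ N') z (combine c d))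
      ≡⟨ sum-combine m {n} (λ z → (M ⊠ N) (combine a b) z * (M' ⊠ N') z (combine c d)) ⟩
    sum {m} (λ i → sum {n} (λ j → (M ⊠ N) (combine a b) (combine i j) * (M' ⊠ N') (combine i j) (combine c d)))
      ≡⟨ sum-cong-≗ {m} (λ i → sum-cong-≗ {n} (λ j → cong₂ _*_ (⊠-combine M N a b i j) (⊠-combine M' N' i j c d))) ⟩
    sum (λ i → sum (λ j → (M a i * N b j) * (M' i c * N' j d)))
      ≡⟨ sum-cong-≗ {m} (λ i → sum-cong-≗ {n} (λ j → interchange (M a i) (N b j) (M' i c) (N' j d))) ⟩
    sum (λ i → sum (λ j → (M a i * M' i c) * (N b j * N' j d)))
      ≡⟨ sum-cong-≗ {m} (λ i → *-distribˡ-sum (M a i * M' i c) (λ j → N b j * N' j d)) ⟨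
    sum (λ i → (M a i * M' i c) * sum (λ j → N b j * N' j d))
      ≡⟨ *-distribʳ-sum _ (λ i → M a i * M' i c) ⟨
    sum (λ i → M a i * M' i c) * sum (λ j → N b j * N' j d)
      ≡⟨ cong₂ _*_ (⊗-sum M M' a c) (⊗-sum N N' b d) ⟨
    (M ⊗ M') a c * (N ⊗ N') b d
      ≡⟨ ⊠-combine (M ⊗ M') (N ⊗ N') a b c d ⟨
    ((M ⊗ M') ⊠ (N ⊗ N')) (combine a b) (combine c d) ∎
    where open ≡-Reasoning

  if-*-if : ∀ x y p q → (if x then p else 0ℚ) * (if y then q else 0ℚ) ≡ (if x ∧ y then p * q else 0ℚ)
  if-*-if true  true  p q = refl
  if-*-if true  false p q = ℚP.*-zeroʳ p
  if-*-if false y     p q = ℚP.*-zeroˡ (if y then q else 0ℚ)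

  diag-⊠ : ∀ {m n} (μ : Fin m → ℚ) (ν : Fin n → ℚ) → diag μ ⊠ diag ν ≋ diag (μ ⊠ᵛ ν)
  diag-⊠ {m} {n} μ ν = ≋-combine {m} {n} λ a b c d → begin
    (diag μ ⊠ diag ν) (combine a b) (combine c d)
      ≡⟨ ⊠-combine (diag μ) (diag ν) a b c d ⟩
    diag μ a c * diag ν b d
      ≡⟨ if-*-if ⌊ a ≟ c ⌋ ⌊ b ≟ d ⌋ (μ a) (ν b) ⟩
    (if ⌊ a ≟ c ⌋ ∧ ⌊ b ≟ d ⌋ then μ a * ν b else 0ℚ)
      ≡⟨ cong₂ (λ t v → if t then v else 0ℚ) (combine-≟ a c b d) (⊠ᵛ-combine μ ν a b) ⟨
    diag (μ ⊠ᵛ ν) (combine a b) (combine c d) ∎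
    where open ≡-Reasoning

  record Eigenvectors {n} (M P : Matrix n) (μ : Fin n → ℚ) : Set where
    constructor mkEigenvectors
    field eigen : M ⊗ P ≋ P ⊗ diag μ

  record LeftInverse {n} (Q P : Matrix n) : Set where
    constructor mkLeftInverse
    field inverse : Q ⊗ P ≋ identity

  open Eigenvectors
  open LeftInverse

  eigenvectors-cong : ∀ {n} {M M' P : Matrix n} {μ μ' : Fin n → ℚ} →
                      M ≋ M' → (∀ k → μ k ≡ μ' k) → Eigenvectors M P μ → Eigenvectors M' P μ'
  eigenvectors-cong {M = M} {M'} {P} {μ} {μ'} M≋M' μ≗μ' (mkEigenvectors eig) = mkEigenvectors λ i j → begin
    (M' ⊗ P) i j     ≡⟨ ⊗-cong {A = M'} {M} {P} {P} (λ a b → sym (M≋M' a b)) (λ _ _ → refl) i j ⟩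
    (M ⊗ P) i j      ≡⟨ eig i j ⟩
    (P ⊗ diag μ) i j ≡⟨ ⊗-diag P μ i j ⟩
    P i j * μ j      ≡⟨ cong (P i j *_) (μ≗μ' j) ⟩
    P i j * μ' j     ≡⟨ ⊗-diag P μ' i j ⟨
    (P ⊗ diag μ') i j ∎
    where open ≡-Reasoning

  eigenvectors-identity : ∀ {n} (P : Matrix n) → Eigenvectors identity P (λ _ → 1ℚ)
  eigenvectors-identity P = mkEigenvectors λ i j → trans (⊗-identityˡ P i j) (sym (⊗-identityʳ P i j))

  eigenvectors-⊖ : ∀ {n} {M N P : Matrix n} {μ ν : Fin n → ℚ} →
                   Eigenvectors M P μ → Eigenvectors N P ν → Eigenvectors (M ⊖ N) P (λ k → μ k - ν k)
  eigenvectors-⊖ {M = M} {N} {P} {μ} {ν} (mkEigenvectors eigM) (mkEigenvectors eigN) = mkEigenvectors λ i j → begin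
    ((M ⊖ N) ⊗ P) i j                    ≡⟨ ⊗-distribʳ-⊖ M N P i j ⟩
    (M ⊗ P) i j - (N ⊗ P) i j            ≡⟨ cong₂ _-_ (eigM i j) (eigN i j) ⟩
    (P ⊗ diag μ) i j - (P ⊗ diag ν) i j  ≡⟨ cong₂ _-_ (⊗-diag P μ i j) (⊗-diag P ν i j) ⟩
    P i j * μ j - P i j * ν j            ≡⟨ x[y-z]≈xy-xz (P i j) (μ j) (ν j) ⟨
    P i j * (μ j - ν j)                  ≡⟨ ⊗-diag P (λ k → μ k - ν k) i j ⟨
    (P ⊗ diag (λ k → μ k - ν k)) i j     ∎
    where open ≡-Reasoning

  eigenvectors-⊠ : ∀ {m n} {M P : Matrix m} {N P' : Matrix n} {μ ν} →
                   Eigenvectors M P μ → Eigenvectors N P' ν → Eigenvectors (M ⊠ N) (P ⊠ P') (μ ⊠ᵛ ν)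
  eigenvectors-⊠ {M = M} {P} {N} {P'} {μ} {ν} (mkEigenvectors eigM) (mkEigenvectors eigN) = mkEigenvectors λ x y → begin
    ((M ⊠ N) ⊗ (P ⊠ P')) x y             ≡⟨ ⊠-⊗ M P N P' x y ⟩
    ((M ⊗ P) ⊠ (N ⊗ P')) x y             ≡⟨ ⊠-cong eigM eigN x y ⟩
    ((P ⊗ diag μ) ⊠ (P' ⊗ diag ν)) x y   ≡⟨ ⊠-⊗ P (diag μ) P' (diag ν) x y ⟨
    ((P ⊠ P') ⊗ (diag μ ⊠ diag ν)) x y   ≡⟨ ⊗-cong {A = P ⊠ P'} {P ⊠ P'} (λ _ _ → refl) (diag-⊠ μ ν) x y ⟩
    ((P ⊠ P') ⊗ diag (μ ⊠ᵛ ν)) x y       ∎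
    where open ≡-Reasoning

  leftInverse-⊠ : ∀ {m n} {Q P : Matrix m} {Q' P' : Matrix n} →
                  LeftInverse Q P → LeftInverse Q' P' → LeftInverse (Q ⊠ Q') (P ⊠ P')
  leftInverse-⊠ {m} {n} {Q} {P} {Q'} {P'} (mkLeftInverse inv) (mkLeftInverse inv') = mkLeftInverse λ x y →
    trans (⊠-⊗ Q P Q' P' x y) (trans (⊠-cong inv inv' x y) (diag-⊠ {m} {n} (λ _ → 1ℚ) (λ _ → 1ℚ) x y))

  sum-ones : ∀ n → sum {n} (λ _ → 1ℚ) ≡ toℚ (+ n)
  sum-ones zero    = refl
  sum-ones (suc n) = trans (cong (_+_ 1ℚ) (sum-ones n)) (sym (toℚ-homo-+ (+ 1) (+ n)))

  sum-identity-column : ∀ {n} (c : Fin n) → sum (λ l → identity l c) ≡ 1ℚ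
  sum-identity-column c = trans (sum-single c _ (λ l l≢c → diag-off _ l≢c)) (diag-on _ c)

  allOnes : ∀ {n} → Matrix n
  allOnes _ _ = 1ℚ

  onesBasis : ∀ {k} → Matrix (suc k)
  onesBasis l zero    = 1ℚ
  onesBasis l (suc j) = identity l zero - identity l (suc j)

  onesEigenvalue : ∀ {k} → Fin (suc k) → ℤ
  onesEigenvalue {k} zero    = + suc k
  onesEigenvalue     (suc _) = + 0

  -- suc k in normal form, so that its NonZero instance is found.
  sucℚ : ℕ → ℚ
  sucℚ k = mkℚ (+ suc k) 0 (Coprime.sym (Coprime.1-coprimeTo _))

  sucℚ-inverse : ∀ k → 1/ sucℚ k * toℚ (+ suc k) ≡ 1ℚ
  sucℚ-inverse k = trans (cong (1/ sucℚ k *_) (toℚ≡mkℚ (+ suc k))) (ℚP.*-inverseˡ (sucℚ k))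

  onesBasisInverse : ∀ {k} → Matrix (suc k)
  onesBasisInverse {k} zero    l = 1/ sucℚ k
  onesBasisInverse {k} (suc i) l = 1/ sucℚ k - identity (suc i) l

  sum-onesBasis : ∀ {k} (j : Fin (suc k)) → sum (λ l → onesBasis l j) ≡ toℚ (onesEigenvalue j)
  sum-onesBasis {k} zero    = sum-ones (suc k)
  sum-onesBasis {k} (suc j) = begin
    sum (λ l → identity l zero - identity l (suc j))
      ≡⟨ ∑-distrib-− {suc k} (λ l → identity l zero) (λ l → identity l (suc j)) ⟩
    sum {suc k} (λ l → identity l zero) - sum (λ l → identity l (suc j))
      ≡⟨ cong₂ _-_ (sum-identity-column {suc k} zero) (sum-identity-column (suc j)) ⟩
    1ℚ - 1ℚ
      ≡⟨ ℚP.+-inverseʳ 1ℚ ⟩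
    0ℚ ∎
    where open ≡-Reasoning

  allOnes-eigenvectors : ∀ {k} → Eigenvectors allOnes (onesBasis {k}) (toℚ ∘ onesEigenvalue)
  allOnes-eigenvectors = mkEigenvectors λ i j → begin
    (allOnes ⊗ onesBasis) i j              ≡⟨ ⊗-sum allOnes onesBasis i j ⟩
    sum (λ l → 1ℚ * onesBasis l j)         ≡⟨ sum-cong-≗ (λ l → ℚP.*-identityˡ (onesBasis l j)) ⟩
    sum (λ l → onesBasis l j)              ≡⟨ sum-onesBasis j ⟩
    toℚ (onesEigenvalue j)                 ≡⟨ scaled j ⟨
    onesBasis i j * toℚ (onesEigenvalue j) ≡⟨ ⊗-diag onesBasis (toℚ ∘ onesEigenvalue) i j ⟨
    (onesBasis ⊗ diag (toℚ ∘ onesEigenvalue)) i j ∎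
    where
    open ≡-Reasoning
    scaled : ∀ {i} j → onesBasis i j * toℚ (onesEigenvalue j) ≡ toℚ (onesEigenvalue j)
    scaled     zero    = ℚP.*-identityˡ _
    scaled {i} (suc j) = ℚP.*-zeroʳ (onesBasis i (suc j))

  onesBasisInverse-leftInverse : ∀ {k} → LeftInverse (onesBasisInverse {k}) onesBasis
  onesBasisInverse-leftInverse {k} = mkLeftInverse λ i j → trans (⊗-sum onesBasisInverse onesBasis i j) (entry i j)
    where
    open +-*-Solver
    r : ℚ
    r = 1/ sucℚ k
    column : ∀ j → sum (λ l → r * onesBasis l j) ≡ r * toℚ (onesEigenvalue j)
    column j = trans (sym (*-distribˡ-sum r (λ l → onesBasis l j))) (cong (r *_) (sum-onesBasis j))
    row : ∀ i j → sum (λ l → (r - identity i l) * onesBasis l j) ≡ r * toℚ (onesEigenvalue j) - onesBasis i j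
    row i j = begin
      sum (λ l → (r - identity i l) * onesBasis l j)
        ≡⟨ sum-cong-≗ (λ l → [y-z]x≈yx-zx (onesBasis l j) r (identity i l)) ⟩
      sum (λ l → r * onesBasis l j - identity i l * onesBasis l j)
        ≡⟨ ∑-distrib-− (λ l → r * onesBasis l j) (λ l → identity i l * onesBasis l j) ⟩
      sum (λ l → r * onesBasis l j) - sum (λ l → identity i l * onesBasis l j)
        ≡⟨ cong₂ _-_ (column j) (trans (sym (⊗-sum identity onesBasis i j)) (⊗-identityˡ onesBasis i j)) ⟩
      r * toℚ (onesEigenvalue j) - onesBasis i j ∎
      where open ≡-Reasoning
    entry : ∀ i j → sum (λ l → onesBasisInverse i l * onesBasis l j) ≡ identity i j
    entry zero    zero    = trans (column zero) (sucℚ-inverse k)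
    entry zero    (suc j) = trans (column (suc j)) (ℚP.*-zeroʳ r)
    entry (suc i) zero    = trans (row (suc i) zero) (trans (cong (_- 1ℚ) (sucℚ-inverse k)) (ℚP.+-inverseʳ 1ℚ))
    entry (suc i) (suc j) = trans (row (suc i) (suc j))
      (solve 2 (λ r x → r :* con 0ℚ :- (con 0ℚ :- x) := x) refl r (identity (suc i) (suc j)))

  count : ∀ {n} → (Fin n → Bool) → ℕ
  count P = ℕΣ.sum (λ j → if P j then 1 else 0)

  degree≡count : ∀ {n} (G : SimpleGraph n) v → degree G v ≡ count (adj G v)
  degree≡count {n} G v = trans (cong (foldr ℕ._+_ 0) (map-tabulate (λ i → i) f)) (foldr-tabulate ℕ._+_ 0 f)
    where
    f : Fin n → ℕ
    f w = if adj G v w then 1 else 0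

  count-true : ∀ n → count {n} (λ _ → true) ≡ n
  count-true zero    = refl
  count-true (suc n) = cong suc (count-true n)

  count-complement : ∀ {n} (P : Fin n → Bool) → count P ℕ.+ count (not ∘ P) ≡ n
  count-complement {zero}  P = refl
  count-complement {suc n} P with P zero
  ... | true  = cong suc (count-complement (P ∘ suc))
  ... | false = trans (ℕP.+-suc (count (P ∘ suc)) _) (cong suc (count-complement (P ∘ suc)))

  count-≟ : ∀ {n} (a : Fin n) → count (λ b → ⌊ a ≟ b ⌋) ≡ 1
  count-≟ a = trans (ℕΣ.sum-single a _ vanish) (cong (λ t → if t then 1 else 0) (⌊⌋-true (a ≟ a) refl))
    where
    vanish : ∀ b → b ≢ a → (if ⌊ a ≟ b ⌋ then 1 else 0) ≡ 0
    vanish b b≢a = cong (λ t → if t then 1 else 0) (⌊⌋-false (a ≟ b) (b≢a ∘ sym))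

  count-≢ : ∀ {k} (a : Fin (suc k)) → count (λ b → not ⌊ a ≟ b ⌋) ≡ k
  count-≢ {k} a = ℕP.suc-injective (trans (cong (ℕ._+ count (λ b → not ⌊ a ≟ b ⌋)) (sym (count-≟ a)))
                                           (count-complement (λ b → ⌊ a ≟ b ⌋)))

  sum-if : ∀ {n} (P : Fin n → Bool) c → ℕΣ.sum (λ j → if P j then c else 0) ≡ count P ℕ.* c
  sum-if P c = trans (ℕΣ.sum-cong-≗ (λ j → scaled (P j))) (sym (ℕΣ.*-distribʳ-sum c (λ j → if P j then 1 else 0)))
    where
    scaled : ∀ b → (if b then c else 0) ≡ (if b then 1 else 0) ℕ.* c
    scaled true  = sym (ℕP.+-identityʳ c)
    scaled false = refl

  reachable-trans : ∀ {n} {G : SimpleGraph n} {u v w} → Reachable G u v → Reachable G v w → Reachable G u w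
  reachable-trans r here         = r
  reachable-trans r (step r' e)  = step (reachable-trans r r') e

  reachable-sym : ∀ {n} {G : SimpleGraph n} {u v} → Reachable G u v → Reachable G v u
  reachable-sym         here                     = here
  reachable-sym {G = G} (step {v} {w} r v~w) =
    reachable-trans (step here (trans (SimpleGraph.sym G w v) v~w)) (reachable-sym r)

  connected-from : ∀ {n} {G : SimpleGraph n} r → (∀ v → Reachable G r v) → Connected G
  connected-from r reach u v = reachable-trans (reachable-sym (reach u)) (reach v)

  ReachableWithin : ∀ {n} → SimpleGraph n → ℕ → Fin n → Fin n → Set
  ReachableWithin G zero    u v = u ≡ v
  ReachableWithin G (suc t) u v = ReachableWithin G t u v ⊎ ∃ λ w → ReachableWithin G t u w × adj G w v ≡ true

  reachableWithin? : ∀ {n} (G : SimpleGraph n) t u v → Dec (ReachableWithin G t u v)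
  reachableWithin? G zero    u v = u ≟ v
  reachableWithin? G (suc t) u v =
    reachableWithin? G t u v ⊎-dec any? (λ w → reachableWithin? G t u w ×-dec adj G w v Bool.≟ true)

  reachableWithin⇒reachable : ∀ {n} {G : SimpleGraph n} t {u v} → ReachableWithin G t u v → Reachable G u v
  reachableWithin⇒reachable zero    refl                = here
  reachableWithin⇒reachable (suc t) (inj₁ r)            = reachableWithin⇒reachable t r
  reachableWithin⇒reachable (suc t) (inj₂ (w , r , e))  = step (reachableWithin⇒reachable t r) e

  -- Blow-ups

  boolMatrix : ∀ {n} → (Fin n → Fin n → Bool) → Matrix n
  boolMatrix R i j = if R i j then 1ℚ else 0ℚ

  Disjoint : ∀ {n} → SimpleGraph n → (Fin n → Fin n → Bool) → Set
  Disjoint E D = ∀ i j → adj E i j ∧ D i j ≡ false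

  module Blowup {m} (E : SimpleGraph m) (D : Fin m → Fin m → Bool) (D-sym : ∀ i j → D i j ≡ D j i) (k : ℕ) where

    E∨D : Fin m → Fin m → Bool
    E∨D i j = adj E i j ∨ D i j

    base : Fin (m ℕ.* suc k) → Fin m
    base = quotient (suc k)

    offset : Fin (m ℕ.* suc k) → Fin (suc k)
    offset = remainder {m} (suc k)

    blowupAdj : Fin m → Fin (suc k) → Fin m → Fin (suc k) → Bool
    blowupAdj i a j b = adj E i j ∨ (D i j ∧ not ⌊ a ≟ b ⌋)

    blowup : SimpleGraph (m ℕ.* suc k)
    blowup = record
      { adj    = λ x y → blowupAdj (base x) (offset x) (base y) (offset y)
      ; sym    = λ x y → blowupAdj-sym (base x) (offset x) (base y) (offset y)
      ; irrefl = λ x → blowupAdj-irrefl (base x) (offset x)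
      }
      where
      blowupAdj-sym : ∀ i a j b → blowupAdj i a j b ≡ blowupAdj j b i a
      blowupAdj-sym i a j b = cong₂ _∨_ (SimpleGraph.sym E i j) (cong₂ _∧_ (D-sym i j) (cong not (≟-sym a b)))
      blowupAdj-irrefl : ∀ i a → blowupAdj i a i a ≡ false
      blowupAdj-irrefl i a =
        trans (cong₂ (λ e t → e ∨ (D i i ∧ not t)) (irrefl E i) (⌊⌋-true (a ≟ a) refl)) (∧-zeroʳ (D i i))

    adj-combine : ∀ i a j b → adj blowup (combine i a) (combine j b) ≡ blowupAdj i a j b
    adj-combine i a j b = cong₂ (λ (p q : Fin m × Fin (suc k)) → blowupAdj (proj₁ p) (proj₂ p) (proj₁ q) (proj₂ q))
                                (remQuot-combine i a) (remQuot-combine j b)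

    adjMatrix-blowup : Disjoint E D → adjMatrix blowup ≋ boolMatrix E∨D ⊠ allOnes ⊖ boolMatrix D ⊠ identity
    adjMatrix-blowup disjoint = ≋-combine {m} {suc k} λ i a j b → begin
      adjMatrix blowup (combine i a) (combine j b)
        ≡⟨ cong (λ t → if t then 1ℚ else 0ℚ) (adj-combine i a j b) ⟩
      (if adj E i j ∨ (D i j ∧ not ⌊ a ≟ b ⌋) then 1ℚ else 0ℚ)
        ≡⟨ entry (adj E i j) (D i j) ⌊ a ≟ b ⌋ (disjoint i j) ⟩
      boolMatrix E∨D i j * 1ℚ - boolMatrix D i j * identity a b
        ≡⟨ cong₂ _-_ (⊠-combine (boolMatrix E∨D) allOnes i a j b) (⊠-combine (boolMatrix D) identity i a j b) ⟨
      (boolMatrix E∨D ⊠ allOnes ⊖ boolMatrix D ⊠ identity) (combine i a) (combine j b) ∎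
      where
      open ≡-Reasoning
      entry : ∀ e d s → e ∧ d ≡ false →
              (if e ∨ (d ∧ not s) then 1ℚ else 0ℚ)
                ≡ (if e ∨ d then 1ℚ else 0ℚ) * 1ℚ - (if d then 1ℚ else 0ℚ) * (if s then 1ℚ else 0ℚ)
      entry true  false true  _ = refl
      entry true  false false _ = refl
      entry false true  true  _ = refl
      entry false true  false _ = refl
      entry false false true  _ = refl
      entry false false false _ = refl
      entry true  true  s     ()

    blowup-integral : Disjoint E D → (P Q : Matrix m) (h d : Fin m → ℤ) →
                      Eigenvectors (boolMatrix E∨D) P (toℚ ∘ h) → Eigenvectors (boolMatrix D) P (toℚ ∘ d) →
                      LeftInverse Q P → Integral blowup
    blowup-integral disjoint P Q h d eigH eigD inv =
      ev , P ⊠ onesBasis , Q ⊠ onesBasisInverse ,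
      eigen eigenvectors , inverse (leftInverse-⊠ inv onesBasisInverse-leftInverse)
      where
      ev : Fin (m ℕ.* suc k) → ℤ
      ev x = h (base x) ℤ.* onesEigenvalue (offset x) ℤ.- d (base x)
      ev-correct : ∀ x → ((toℚ ∘ h) ⊠ᵛ (toℚ ∘ onesEigenvalue)) x - ((toℚ ∘ d) ⊠ᵛ (λ _ → 1ℚ)) x ≡ toℚ (ev x)
      ev-correct x = begin
        toℚ (h i) * toℚ (onesEigenvalue a) - toℚ (d i) * 1ℚ
          ≡⟨ cong (_-_ (toℚ (h i) * toℚ (onesEigenvalue a))) (ℚP.*-identityʳ (toℚ (d i))) ⟩
        toℚ (h i) * toℚ (onesEigenvalue a) - toℚ (d i)
          ≡⟨ cong (_- toℚ (d i)) (toℚ-homo-* (h i) (onesEigenvalue a)) ⟨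
        toℚ (h i ℤ.* onesEigenvalue a) - toℚ (d i)
          ≡⟨ toℚ-homo-− (h i ℤ.* onesEigenvalue a) (d i) ⟨
        toℚ (ev x) ∎
        where
        open ≡-Reasoning
        i : Fin m
        i = base x
        a : Fin (suc k)
        a = offset x
      eigenvectors : Eigenvectors (adjMatrix blowup) (P ⊠ onesBasis) (toℚ ∘ ev)
      eigenvectors = eigenvectors-cong (λ x y → sym (adjMatrix-blowup disjoint x y)) ev-correct
        (eigenvectors-⊖ (eigenvectors-⊠ eigH allOnes-eigenvectors) (eigenvectors-⊠ eigD (eigenvectors-identity onesBasis)))

    fibre-degree : ∀ e d → e ∧ d ≡ false → (a : Fin (suc k)) →
                   count (λ b → e ∨ (d ∧ not ⌊ a ≟ b ⌋)) ≡ (if e then suc k else 0) ℕ.+ (if d then k else 0)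
    fibre-degree true  false _ a = trans (count-true (suc k)) (sym (ℕP.+-identityʳ (suc k)))
    fibre-degree false true  _ a = count-≢ a
    fibre-degree false false _ a = ℕΣ.sum-replicate-zero (suc k)
    fibre-degree true  true  () a

    degree-blowup : Disjoint E D → ∀ i a → degree blowup (combine i a) ≡ degree E i ℕ.* suc k ℕ.+ count (D i) ℕ.* k
    degree-blowup disjoint i a = begin
      degree blowup (combine i a)
        ≡⟨ degree≡count blowup (combine i a) ⟩
      count (adj blowup (combine i a))
        ≡⟨ ℕΣ.sum-combine m {suc k} _ ⟩
      ℕΣ.sum {m} (λ j → count {suc k} (λ b → adj blowup (combine i a) (combine j b)))
        ≡⟨ ℕΣ.sum-cong-≗ (λ j → ℕΣ.sum-cong-≗ (λ b → cong (λ t → if t then 1 else 0) (adj-combine i a j b))) ⟩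
      ℕΣ.sum {m} (λ j → count {suc k} (λ b → blowupAdj i a j b))
        ≡⟨ ℕΣ.sum-cong-≗ (λ j → fibre-degree (adj E i j) (D i j) (disjoint i j) a) ⟩
      ℕΣ.sum {m} (λ j → (if adj E i j then suc k else 0) ℕ.+ (if D i j then k else 0))
        ≡⟨ ℕΣ.∑-distrib-+ (λ j → if adj E i j then suc k else 0) (λ j → if D i j then k else 0) ⟩
      ℕΣ.sum {m} (λ j → if adj E i j then suc k else 0) ℕ.+ ℕΣ.sum {m} (λ j → if D i j then k else 0)
        ≡⟨ cong₂ ℕ._+_ (sum-if (adj E i) (suc k)) (sum-if (D i) k) ⟩
      count (adj E i) ℕ.* suc k ℕ.+ count (D i) ℕ.* k
        ≡⟨ cong (λ t → t ℕ.* suc k ℕ.+ count (D i) ℕ.* k) (degree≡count E i) ⟨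
      degree E i ℕ.* suc k ℕ.+ count (D i) ℕ.* k ∎
      where open ≡-Reasoning

    blowup-connected : (∀ i → D i i ≡ true) → Connected E → Connected blowup
    blowup-connected D-refl connected =
      combine-elim (λ x → ∀ y → Reachable blowup x y) λ i a →
      combine-elim (Reachable blowup (combine i a)) λ j b → lift (connected i j) a b
      where
      lift : ∀ {i j} → Reachable E i j → ∀ a b → Reachable blowup (combine i a) (combine j b)
      lift {i} here a b with a ≟ b
      ... | yes refl = here
      ... | no a≢b   = step here (trans (adj-combine i a i b)
                         (trans (cong₂ (λ d t → adj E i i ∨ (d ∧ not t)) (D-refl i) (⌊⌋-false (a ≟ b) a≢b))
                                (∨-zeroʳ (adj E i i))))
      lift (step {v} {w} r v~w) a b = step (lift r a b) (trans (adj-combine v b w b) (cong (_∨ _) v~w))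

  -- The base graph on a 3 × 4 grid

  row : Fin 12 → Fin 3
  row i = quotient 4 i

  column : Fin 12 → Fin 4
  column i = remainder {3} 4 i

  parity : Fin 12 → Fin 2
  parity i = remainder {2} 2 (column i)

  grid : SimpleGraph 12
  grid = record
    { adj    = λ i j → not ⌊ row i ≟ row j ⌋ ∧ not ⌊ parity i ≟ parity j ⌋
    ; sym    = λ i j → cong₂ (λ s t → not s ∧ not t) (≟-sym (row i) (row j)) (≟-sym (parity i) (parity j))
    ; irrefl = λ i → cong (λ t → not t ∧ not ⌊ parity i ≟ parity i ⌋) (⌊⌋-true (row i ≟ row i) refl)
    }

  sameColumn : Fin 12 → Fin 12 → Bool
  sameColumn i j = ⌊ column i ≟ column j ⌋

  sameColumn-sym : ∀ i j → sameColumn i j ≡ sameColumn j i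
  sameColumn-sym i j = ≟-sym (column i) (column j)

  sameColumn-refl : ∀ i → sameColumn i i ≡ true
  sameColumn-refl i = ⌊⌋-true (column i ≟ column i) refl

  grid-disjoint : Disjoint grid sameColumn
  grid-disjoint = from-yes (all? λ i → all? λ j → adj grid i j ∧ sameColumn i j Bool.≟ false)

  grid-regular : ∀ i → degree grid i ≡ 4
  grid-regular = from-yes (all? λ i → degree grid i ℕ.≟ 4)

  sameColumn-count : ∀ i → count (sameColumn i) ≡ 3
  sameColumn-count = from-yes (all? λ i → count (sameColumn i) ℕ.≟ 3)

  grid-connected : Connected grid
  grid-connected = connected-from zero λ v → reachableWithin⇒reachable 3 (within3 v)
    where
    within3 : ∀ v → ReachableWithin grid 3 zero v
    within3 = from-yes (all? λ v → reachableWithin? grid 3 zero v)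

  -- With i = 4 · row + 2 q + parity, sameColumn is J₃ ⊗ I₂ ⊗ I₂ and grid is (J₃ - I₃) ⊗ J₂ ⊗ (J₂ - I₂),
  -- so both are diagonal in the Kronecker product of the eigenbases of J₃, J₂ and J₂.
  gridBasis : Matrix 12
  gridBasis = onesBasis {2} ⊠ (onesBasis {1} ⊠ onesBasis {1})

  gridBasisInverse : Matrix 12
  gridBasisInverse = onesBasisInverse {2} ⊠ (onesBasisInverse {1} ⊠ onesBasisInverse {1})

  gridBasis-leftInverse : LeftInverse gridBasisInverse gridBasis
  gridBasis-leftInverse =
    leftInverse-⊠ onesBasisInverse-leftInverse (leftInverse-⊠ onesBasisInverse-leftInverse onesBasisInverse-leftInverse)

  gridOrSameColumn : Fin 12 → Fin 12 → Bool
  gridOrSameColumn i j = adj grid i j ∨ sameColumn i j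

  gridOrSameColumn-eigenvalue : Fin 12 → ℤ
  gridOrSameColumn-eigenvalue i =
    lookup (+ 7 ∷ ℤ.- + 1 ∷ + 3 ∷ + 3 ∷ ℤ.- + 2 ∷ + 2 ∷ + 0 ∷ + 0 ∷ ℤ.- + 2 ∷ + 2 ∷ + 0 ∷ + 0 ∷ []) i

  sameColumn-eigenvalue : Fin 12 → ℤ
  sameColumn-eigenvalue i =
    lookup (+ 3 ∷ + 3 ∷ + 3 ∷ + 3 ∷ + 0 ∷ + 0 ∷ + 0 ∷ + 0 ∷ + 0 ∷ + 0 ∷ + 0 ∷ + 0 ∷ []) i

  gridOrSameColumn-eigenvectors :
    Eigenvectors (boolMatrix gridOrSameColumn) gridBasis (toℚ ∘ gridOrSameColumn-eigenvalue)
  gridOrSameColumn-eigenvectors = mkEigenvectors (from-yes (all? λ i → all? λ j →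
    (boolMatrix gridOrSameColumn ⊗ gridBasis) i j ℚP.≟ (gridBasis ⊗ diag (toℚ ∘ gridOrSameColumn-eigenvalue)) i j))

  sameColumn-eigenvectors : Eigenvectors (boolMatrix sameColumn) gridBasis (toℚ ∘ sameColumn-eigenvalue)
  sameColumn-eigenvectors = mkEigenvectors (from-yes (all? λ i → all? λ j →
    (boolMatrix sameColumn ⊗ gridBasis) i j ℚP.≟ (gridBasis ⊗ diag (toℚ ∘ sameColumn-eigenvalue)) i j))

  7[1+k]≡3+4[1+k]+3k : ∀ k → 7 ℕ.* suc k ≡ 3 ℕ.+ (4 ℕ.* suc k ℕ.+ 3 ℕ.* k)
  7[1+k]≡3+4[1+k]+3k = solve-∀

  module GridBlowup = Blowup grid sameColumn sameColumn-sym

  gridBlowup : ∀ k → SimpleGraph (12 ℕ.* suc k)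
  gridBlowup = GridBlowup.blowup

  gridBlowup-connected : ∀ k → Connected (gridBlowup k)
  gridBlowup-connected k = GridBlowup.blowup-connected k sameColumn-refl grid-connected

  gridBlowup-regular : ∀ k → Regular (gridBlowup k) (7 ℕ.* suc k ℕ.∸ 3)
  gridBlowup-regular k = combine-elim (λ x → degree (gridBlowup k) x ≡ 7 ℕ.* suc k ℕ.∸ 3) λ i a → begin
    degree (gridBlowup k) (combine i a)
      ≡⟨ GridBlowup.degree-blowup k grid-disjoint i a ⟩
    degree grid i ℕ.* suc k ℕ.+ count (sameColumn i) ℕ.* k
      ≡⟨ cong₂ (λ d c → d ℕ.* suc k ℕ.+ c ℕ.* k) (grid-regular i) (sameColumn-count i) ⟩
    4 ℕ.* suc k ℕ.+ 3 ℕ.* k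
      ≡⟨ ℕP.m+n∸m≡n 3 _ ⟨
    3 ℕ.+ (4 ℕ.* suc k ℕ.+ 3 ℕ.* k) ℕ.∸ 3
      ≡⟨ cong (ℕ._∸ 3) (7[1+k]≡3+4[1+k]+3k k) ⟨
    7 ℕ.* suc k ℕ.∸ 3 ∎
    where open ≡-Reasoning

  gridBlowup-integral : ∀ k → Integral (gridBlowup k)
  gridBlowup-integral k =
    GridBlowup.blowup-integral k grid-disjoint gridBasis gridBasisInverse gridOrSameColumn-eigenvalue sameColumn-eigenvalue
      gridOrSameColumn-eigenvectors sameColumn-eigenvectors gridBasis-leftInverse

open Construction using (gridBlowup; gridBlowup-connected; gridBlowup-regular; gridBlowup-integral)

open import Data.Nat using (ℕ; zero; suc; _*_; _∸_; _>_)
open import Data.Product using (Σ; _×_; _,_)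

-- The construction works for every p ≥ 1; the hypothesis p > 2 only excludes p = 0.
corollary2 : ∀ (p : ℕ) → p > 2 →
    Σ (SimpleGraph (12 * p)) λ G →
    Connected G × Regular G (7 * p ∸ 3) × Integral G
corollary2 zero    ()
corollary2 (suc k) _ = gridBlowup k , gridBlowup-connected k , gridBlowup-regular k , gridBlowup-integral k
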